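{- ${\tt BWT}(u_k^R) = (\mathtt{a}\mathtt{b})^{k}(\prod_{i=1}^k\text{\tt \&}_i) (\prod_{i=2}^k\text{\tt \#}_i)\, \text{\tt \#}_1\, \mathtt{a}^k$ and $r(u_k^R)=4k+1$.
   Context: Let $k\ge 1$ and let $\Sigma = \{\mathtt{a},\mathtt{b}\} \cup \bigcup_{i\in[1,k]} \{\text{\tt \#}_i,\text{\tt \&}_i\}$ be ordered as $\text{\tt \#}_1< \text{\tt \&}_1 < \text{\tt \#}_2 < \text{\tt \&}_2 < \dots < \text{\tt \#}_k < \text{\tt \&}_k < \mathtt{a} < \mathtt{b}$. Define $u_k = \prod_{i=1}^k \mathtt{b}\,\mathtt{a}\,\text{\tt \#}_i\,\mathtt{a}\,\text{\tt \&}_i$ (so $|u_k|=5k$), and $u_k^R$ is its reverse. For a string $w$, ${\tt BWT}(w)$ is the string of last characters of the lexicographically sorted rotations of $w$, and $r(w)$ is the number of runs (maximal equal-symbol blocks) in ${\tt BWT}(w)$. -}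

module Defs where

open import Data.Nat using (ℕ; zero; suc; _+_; _*_; _<ᵇ_; _≡ᵇ_)
open import Data.Bool using (Bool; true; false; _∧_; _∨_; if_then_else_)
open import Data.List using (List; []; _∷_; _++_; reverse; length; replicate; concat; map; last)
open import Data.List.Base using (applyUpTo)
open import Data.Maybe using (Maybe; just; nothing)

-- Alphabet: #_i, &_i (i ≥ 1), a, b
data Sym : Set where
  hash : ℕ → Sym
  amp  : ℕ → Sym
  sa   : Sym
  sb   : Sym

-- rank: #_i ↦ 2i, &_i ↦ 2i+1, a and b above every separator.
-- Order: #_1 < &_1 < #_2 < ... < #_k < &_k < a < b (for any k).
-- Strict order as a Boolean test.
_<ₛ_ : Sym → Sym → Bool
hash i <ₛ hash j = i <ᵇ j
hash i <ₛ amp j  = (i <ᵇ j) ∨ (i ≡ᵇ j)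
amp i  <ₛ hash j = i <ᵇ j
amp i  <ₛ amp j  = i <ᵇ j
hash _ <ₛ sa = true
hash _ <ₛ sb = true
amp _  <ₛ sa = true
amp _  <ₛ sb = true
sa <ₛ sb = true
_ <ₛ _ = false

_≡ₛ_ : Sym → Sym → Bool
hash i ≡ₛ hash j = i ≡ᵇ j
amp i  ≡ₛ amp j  = i ≡ᵇ j
sa ≡ₛ sa = true
sb ≡ₛ sb = true
_ ≡ₛ _ = false

_≤ₗ_ : List Sym → List Sym → Bool
[] ≤ₗ _ = true
(_ ∷ _) ≤ₗ [] = false
(x ∷ xs) ≤ₗ (y ∷ ys) = (x <ₛ y) ∨ ((x ≡ₛ y) ∧ (xs ≤ₗ ys))

insert : List Sym → List (List Sym) → List (List Sym)
insert v [] = v ∷ []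
insert v (w ∷ ws) = if v ≤ₗ w then v ∷ w ∷ ws else w ∷ insert v ws

sortWords : List (List Sym) → List (List Sym)
sortWords [] = []
sortWords (w ∷ ws) = insert w (sortWords ws)

rotate1 : List Sym → List Sym
rotate1 [] = []
rotate1 (x ∷ xs) = xs ++ (x ∷ [])

rotationsAux : ℕ → List Sym → List (List Sym)
rotationsAux zero _ = []
rotationsAux (suc n) w = w ∷ rotationsAux n (rotate1 w)

rotations : List Sym → List (List Sym)
rotations w = rotationsAux (length w) w

lastChars : List (List Sym) → List Sym
lastChars [] = []
lastChars (w ∷ ws) with last w
... | just c  = c ∷ lastChars ws
... | nothing = lastChars ws

BWT : List Sym → List Sym
BWT w = lastChars (sortWords (rotations w))

runsAux : Sym → List Sym → ℕ
runsAux _ [] = 1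
runsAux p (x ∷ xs) = if p ≡ₛ x then runsAux x xs else suc (runsAux x xs)

runs : List Sym → ℕ
runs [] = 0
runs (x ∷ xs) = runsAux x xs

r : List Sym → ℕ
r w = runs (BWT w)

block : ℕ → List Sym
block i = sb ∷ sa ∷ hash i ∷ sa ∷ amp i ∷ []

u : ℕ → List Sym
u k = concat (applyUpTo (λ j → block (suc j)) k)

expectedBWT : ℕ → List Sym
expectedBWT k =
  concat (replicate k (sa ∷ sb ∷ []))
  ++ applyUpTo (λ j → amp (suc j)) k
  ++ applyUpTo (λ j → hash (suc (suc j))) (k Data.Nat.∸ 1)
  ++ hash 1 ∷ replicate k sa

-- Lexicographic comparison of words is a decidable total order and sortWords is
-- insertion sort for it, so sortWords returns the unique sorted permutation of its
-- input; the BWT is therefore read off any sorted listing of the rotations.  Moving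
-- the final letters a b of reverse (u k) to the front gives the conjugate word
-- D_k ⋯ D_1 with D_j = a b &_j a #_j, which has the same rotations.  The five
-- rotations starting inside D_j begin with #_j, &_j, a #_j, a b &_j and b &_j;
-- listing the #- and &-rotations alternately by index, then the a #-, a b &- and
-- b &-rotations by index, is sorted.  Their last letters are a, b, &_j, #_(j+1)
-- (#_1 for j = k) and a, which is the claimed BWT.  In it consecutive letters differ
-- except inside the final block a^k, giving 4k + 1 runs.
module Submission where

open import Defs
open import Data.Bool using (true; false; T; _∨_; if_then_else_)
open import Data.Bool.Properties using (T-∨; T-∧; T-≡)
open import Data.Empty using (⊥-elim)
open import Data.List
  using (List; []; _∷_; _++_; [_]; _∷ʳ_; length; reverse; concat; replicate; applyUpTo; last; head)
open import Data.List.Properties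
  using (≡-dec; ++-assoc; ++-identityʳ; reverse-++; applyUpTo-∷ʳ; length-++; length-applyUpTo)
open import Data.List.Relation.Binary.Permutation.Propositional
  using (_↭_; ↭-refl; ↭-sym; ↭-trans; ↭⇒↭ₛ; module PermutationReasoning)
import Data.List.Relation.Binary.Permutation.Propositional.Properties as ↭
import Data.List.Relation.Binary.Permutation.Setoid as SetoidPermutation
open import Data.List.Relation.Binary.Pointwise using (Pointwise-≡⇒≡)
open import Data.List.Relation.Unary.Linked using (Linked; [-]; _∷_; _∷′_; head′; tail)
open import Data.List.Relation.Unary.Linked.Properties using (applyUpTo⁺₂)
open import Data.List.Relation.Unary.Sorted.TotalOrder.Properties using (↗↭↗⇒≋)
open import Data.Maybe using (just; nothing)
open import Data.Maybe.Relation.Binary.Connected using (Connected; just)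
open import Data.Nat using (ℕ; zero; suc; _+_; _*_; _∸_; pred; _<_; _≥_; _<ᵇ_; _≡ᵇ_; s≤s; z≤n; _≤?_)
open import Data.Nat.Properties
  using (<ᵇ⇒<; <⇒<ᵇ; ≡ᵇ⇒≡; ≡⇒≡ᵇ; <-cmp; <-irrefl; <-trans; ≤-<-trans; <-≤-trans; ≤-pred; ≰⇒>;
         n<1+n; +-comm; +-suc; +-identityʳ; m+n∸m≡n; +-∸-assoc; n∸n≡0)
open import Data.Nat.Tactic.RingSolver using (solve-∀)
open import Data.Product using (_×_; _,_)
open import Data.Sum using (_⊎_; inj₁; inj₂; [_,_]′)
open import Function using (Equivalence; _∘_)
open import Level using (0ℓ)
open import Relation.Binary using (Rel; tri<; tri≈; tri>; DecidableEquality; DecTotalOrder)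
open import Relation.Binary.PropositionalEquality
  using (_≡_; _≢_; refl; sym; trans; cong; cong₂; subst; isEquivalence; setoid; module ≡-Reasoning)
open import Relation.Nullary using (¬_; yes; no)
open import Relation.Nullary.Decidable using (map′; T?)

≡ₛ-refl : ∀ x → (x ≡ₛ x) ≡ true
≡ₛ-refl (hash i) = Equivalence.to T-≡ (≡⇒≡ᵇ i i refl)
≡ₛ-refl (amp i)  = Equivalence.to T-≡ (≡⇒≡ᵇ i i refl)
≡ₛ-refl sa       = refl
≡ₛ-refl sb       = refl

≡ₛ⇒≡ : ∀ x y → T (x ≡ₛ y) → x ≡ y
≡ₛ⇒≡ (hash i) (hash j) p = cong hash (≡ᵇ⇒≡ i j p)
≡ₛ⇒≡ (amp i)  (amp j)  p = cong amp (≡ᵇ⇒≡ i j p)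
≡ₛ⇒≡ sa       sa       _ = refl
≡ₛ⇒≡ sb       sb       _ = refl

_≟ₛ_ : DecidableEquality Sym
x ≟ₛ y = map′ (≡ₛ⇒≡ x y) (λ { refl → Equivalence.from T-≡ (≡ₛ-refl x) }) (T? (x ≡ₛ y))

≢⇒≡ₛ-false : ∀ {x y} → x ≢ y → (x ≡ₛ y) ≡ false
≢⇒≡ₛ-false {x} {y} x≢y with x ≡ₛ y in eq
... | true  = ⊥-elim (x≢y (≡ₛ⇒≡ x y (Equivalence.from T-≡ eq)))
... | false = refl

<ᵇ-∨-≡ᵇ : ∀ i j → (i <ᵇ j) ∨ (i ≡ᵇ j) ≡ (i <ᵇ suc j)
<ᵇ-∨-≡ᵇ zero    zero    = refl
<ᵇ-∨-≡ᵇ zero    (suc j) = refl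
<ᵇ-∨-≡ᵇ (suc i) zero    = refl
<ᵇ-∨-≡ᵇ (suc i) (suc j) = <ᵇ-∨-≡ᵇ i j

hash<amp⇒< : ∀ i j → T (hash i <ₛ amp j) → i < suc j
hash<amp⇒< i j p = <ᵇ⇒< i (suc j) (subst T (<ᵇ-∨-≡ᵇ i j) p)

<⇒hash<amp : ∀ i j → i < suc j → T (hash i <ₛ amp j)
<⇒hash<amp i j p = subst T (sym (<ᵇ-∨-≡ᵇ i j)) (<⇒<ᵇ p)

hash<amp : ∀ i → T (hash i <ₛ amp i)
hash<amp i = <⇒hash<amp i i (n<1+n i)

n<ᵇ1+n : ∀ i → T (i <ᵇ suc i)
n<ᵇ1+n i = <⇒<ᵇ (n<1+n i)

<ₛ-irrefl : ∀ x → ¬ T (x <ₛ x)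
<ₛ-irrefl (hash i) p = <-irrefl refl (<ᵇ⇒< i i p)
<ₛ-irrefl (amp i)  p = <-irrefl refl (<ᵇ⇒< i i p)

<ₛ-trans : ∀ x y z → T (x <ₛ y) → T (y <ₛ z) → T (x <ₛ z)
<ₛ-trans (hash i) (hash j) (hash l) p q = <⇒<ᵇ (<-trans (<ᵇ⇒< i j p) (<ᵇ⇒< j l q))
<ₛ-trans (hash i) (hash j) (amp l)  p q = <⇒hash<amp i l (<-trans (<ᵇ⇒< i j p) (hash<amp⇒< j l q))
<ₛ-trans (hash i) (amp j)  (hash l) p q = <⇒<ᵇ (≤-<-trans (≤-pred (hash<amp⇒< i j p)) (<ᵇ⇒< j l q))
<ₛ-trans (hash i) (amp j)  (amp l)  p q = <⇒hash<amp i l (<-trans (hash<amp⇒< i j p) (s≤s (<ᵇ⇒< j l q)))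
<ₛ-trans (amp i)  (hash j) (hash l) p q = <⇒<ᵇ (<-trans (<ᵇ⇒< i j p) (<ᵇ⇒< j l q))
<ₛ-trans (amp i)  (hash j) (amp l)  p q = <⇒<ᵇ (<-≤-trans (<ᵇ⇒< i j p) (≤-pred (hash<amp⇒< j l q)))
<ₛ-trans (amp i)  (amp j)  (hash l) p q = <⇒<ᵇ (<-trans (<ᵇ⇒< i j p) (<ᵇ⇒< j l q))
<ₛ-trans (amp i)  (amp j)  (amp l)  p q = <⇒<ᵇ (<-trans (<ᵇ⇒< i j p) (<ᵇ⇒< j l q))
<ₛ-trans (hash _) _        sa       _ _ = _
<ₛ-trans (hash _) _        sb       _ _ = _
<ₛ-trans (amp _)  _        sa       _ _ = _
<ₛ-trans (amp _)  _        sb       _ _ = _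
<ₛ-trans sa       sb       _        _ ()
<ₛ-trans (hash _) sa       (hash _) _ ()
<ₛ-trans (hash _) sa       (amp _)  _ ()
<ₛ-trans (hash _) sb       (hash _) _ ()
<ₛ-trans (hash _) sb       (amp _)  _ ()
<ₛ-trans (amp _)  sa       (hash _) _ ()
<ₛ-trans (amp _)  sa       (amp _)  _ ()
<ₛ-trans (amp _)  sb       (hash _) _ ()
<ₛ-trans (amp _)  sb       (amp _)  _ ()

<ₛ-tri : ∀ x y → T (x <ₛ y) ⊎ x ≡ y ⊎ T (y <ₛ x)
<ₛ-tri (hash i) (hash j) with <-cmp i j
... | tri< i<j _ _    = inj₁ (<⇒<ᵇ i<j)
... | tri≈ _ refl _   = inj₂ (inj₁ refl)
... | tri> _ _ j<i    = inj₂ (inj₂ (<⇒<ᵇ j<i))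
<ₛ-tri (hash i) (amp j) with i ≤? j
... | yes i≤j = inj₁ (<⇒hash<amp i j (s≤s i≤j))
... | no  i≰j = inj₂ (inj₂ (<⇒<ᵇ (≰⇒> i≰j)))
<ₛ-tri (amp i) (hash j) with j ≤? i
... | yes j≤i = inj₂ (inj₂ (<⇒hash<amp j i (s≤s j≤i)))
... | no  j≰i = inj₁ (<⇒<ᵇ (≰⇒> j≰i))
<ₛ-tri (amp i) (amp j) with <-cmp i j
... | tri< i<j _ _    = inj₁ (<⇒<ᵇ i<j)
... | tri≈ _ refl _   = inj₂ (inj₁ refl)
... | tri> _ _ j<i    = inj₂ (inj₂ (<⇒<ᵇ j<i))
<ₛ-tri (hash _) sa       = inj₁ _
<ₛ-tri (hash _) sb       = inj₁ _
<ₛ-tri (amp _)  sa       = inj₁ _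
<ₛ-tri (amp _)  sb       = inj₁ _
<ₛ-tri sa       (hash _) = inj₂ (inj₂ _)
<ₛ-tri sa       (amp _)  = inj₂ (inj₂ _)
<ₛ-tri sb       (hash _) = inj₂ (inj₂ _)
<ₛ-tri sb       (amp _)  = inj₂ (inj₂ _)
<ₛ-tri sa       sa       = inj₂ (inj₁ refl)
<ₛ-tri sa       sb       = inj₁ _
<ₛ-tri sb       sa       = inj₂ (inj₂ _)
<ₛ-tri sb       sb       = inj₂ (inj₁ refl)

-- A record rather than T (xs ≤ₗ ys) so that xs and ys can be inferred.
record _≼_ (xs ys : List Sym) : Set where
  constructor ≼⁺
  field ≼⁻ : T (xs ≤ₗ ys)

≼-head : ∀ {x y xs ys} → T (x <ₛ y) → (x ∷ xs) ≼ (y ∷ ys)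
≼-head p = ≼⁺ (Equivalence.from T-∨ (inj₁ p))

≼-tail : ∀ {x xs ys} → xs ≼ ys → (x ∷ xs) ≼ (x ∷ ys)
≼-tail {x} (≼⁺ p) =
  ≼⁺ (Equivalence.from T-∨ (inj₂ (Equivalence.from T-∧ (Equivalence.from T-≡ (≡ₛ-refl x) , p))))

≼-∷⁻ : ∀ {x y xs ys} → (x ∷ xs) ≼ (y ∷ ys) → T (x <ₛ y) ⊎ (x ≡ y × xs ≼ ys)
≼-∷⁻ {x} {y} (≼⁺ p) with Equivalence.to T-∨ p
... | inj₁ x<y = inj₁ x<y
... | inj₂ q with x ≡ₛ y in eq
...   | true = inj₂ (≡ₛ⇒≡ x y (Equivalence.from T-≡ eq) , ≼⁺ q)

≼-refl : ∀ xs → xs ≼ xs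
≼-refl []       = ≼⁺ _
≼-refl (x ∷ xs) = ≼-tail (≼-refl xs)

≼-trans : ∀ {xs ys zs} → xs ≼ ys → ys ≼ zs → xs ≼ zs
≼-trans {[]} _ _ = ≼⁺ _
≼-trans {x ∷ xs} {y ∷ ys} {z ∷ zs} p q with ≼-∷⁻ p | ≼-∷⁻ q
... | inj₁ x<y         | inj₁ y<z         = ≼-head (<ₛ-trans x y z x<y y<z)
... | inj₁ x<y         | inj₂ (refl , _)  = ≼-head x<y
... | inj₂ (refl , _)  | inj₁ y<z         = ≼-head y<z
... | inj₂ (refl , p′) | inj₂ (refl , q′) = ≼-tail (≼-trans p′ q′)

≼-antisym : ∀ {xs ys} → xs ≼ ys → ys ≼ xs → xs ≡ ys
≼-antisym {[]} {[]} _ _ = refl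
≼-antisym {x ∷ xs} {y ∷ ys} p q with ≼-∷⁻ p | ≼-∷⁻ q
... | inj₁ x<y         | inj₁ y<x        = ⊥-elim (<ₛ-irrefl x (<ₛ-trans x y x x<y y<x))
... | inj₁ x<y         | inj₂ (refl , _) = ⊥-elim (<ₛ-irrefl x x<y)
... | inj₂ (refl , _)  | inj₁ y<x        = ⊥-elim (<ₛ-irrefl x y<x)
... | inj₂ (refl , p′) | inj₂ (_ , q′)   = cong (x ∷_) (≼-antisym p′ q′)

≼-total : ∀ xs ys → xs ≼ ys ⊎ ys ≼ xs
≼-total []       _        = inj₁ (≼⁺ _)
≼-total (_ ∷ _)  []       = inj₂ (≼⁺ _)
≼-total (x ∷ xs) (y ∷ ys) with <ₛ-tri x y
... | inj₁ x<y         = inj₁ (≼-head x<y)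
... | inj₂ (inj₁ refl) = [ inj₁ ∘ ≼-tail , inj₂ ∘ ≼-tail ]′ (≼-total xs ys)
... | inj₂ (inj₂ y<x)  = inj₂ (≼-head y<x)

≼-decTotalOrder : DecTotalOrder 0ℓ 0ℓ 0ℓ
≼-decTotalOrder = record
  { Carrier         = List Sym
  ; _≈_             = _≡_
  ; _≤_             = _≼_
  ; isDecTotalOrder = record
    { isTotalOrder = record
      { isPartialOrder = record
        { isPreorder = record
          { isEquivalence = isEquivalence
          ; reflexive     = λ { {xs} refl → ≼-refl xs }
          ; trans         = ≼-trans
          }
        ; antisym = ≼-antisym
        }
      ; total = ≼-total
      }
    ; _≟_  = ≡-dec _≟ₛ_
    ; _≤?_ = λ xs ys → map′ ≼⁺ _≼_.≼⁻ (T? (xs ≤ₗ ys))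
    }
  }

open DecTotalOrder ≼-decTotalOrder using (totalOrder)
open import Data.List.Sort.InsertionSort ≼-decTotalOrder as InsertionSort using (insertionSort)
open import Data.List.Sort.Base totalOrder using (SortingAlgorithm)
open import Data.List.Relation.Unary.Sorted.TotalOrder totalOrder using (Sorted)

insert≡InsertionSort-insert : ∀ v ws → insert v ws ≡ InsertionSort.insert v ws
insert≡InsertionSort-insert v []       = refl
insert≡InsertionSort-insert v (w ∷ ws) =
  cong (λ l → if v ≤ₗ w then v ∷ w ∷ ws else w ∷ l) (insert≡InsertionSort-insert v ws)

sortWords≡InsertionSort-sort : ∀ ws → sortWords ws ≡ InsertionSort.sort ws
sortWords≡InsertionSort-sort []       = refl
sortWords≡InsertionSort-sort (w ∷ ws) =
  trans (cong (insert w) (sortWords≡InsertionSort-sort ws))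
        (insert≡InsertionSort-insert w (InsertionSort.sort ws))

sortWords-unique : ∀ {ws vs} → Sorted vs → ws ↭ vs → sortWords ws ≡ vs
sortWords-unique {ws} vs↗ ws↭vs = trans (sortWords≡InsertionSort-sort ws)
  (Pointwise-≡⇒≡ (↗↭↗⇒≋ totalOrder (sort-↗ ws) vs↗
    (SetoidPermutation.↭-trans (setoid (List Sym)) (sort-↭ₛ ws) (↭⇒↭ₛ ws↭vs))))
  where open SortingAlgorithm insertionSort

-- rotationsIn y x: the rotations of y ++ x that start inside y.
rotationsIn : List Sym → List Sym → List (List Sym)
rotationsIn []      x = []
rotationsIn (c ∷ y) x = (c ∷ y ++ x) ∷ rotationsIn y (x ∷ʳ c)

rotationsAux≡rotationsIn : ∀ y x → rotationsAux (length y) (y ++ x) ≡ rotationsIn y x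
rotationsAux≡rotationsIn []      x = refl
rotationsAux≡rotationsIn (c ∷ y) x = cong ((c ∷ y ++ x) ∷_) (begin
  rotationsAux (length y) ((y ++ x) ∷ʳ c) ≡⟨ cong (rotationsAux (length y)) (++-assoc y x [ c ]) ⟩
  rotationsAux (length y) (y ++ x ∷ʳ c)   ≡⟨ rotationsAux≡rotationsIn y (x ∷ʳ c) ⟩
  rotationsIn y (x ∷ʳ c)                  ∎)
  where open ≡-Reasoning

rotations≡rotationsIn : ∀ w → rotations w ≡ rotationsIn w []
rotations≡rotationsIn w = begin
  rotationsAux (length w) w         ≡⟨ cong (rotationsAux (length w)) (++-identityʳ w) ⟨
  rotationsAux (length w) (w ++ []) ≡⟨ rotationsAux≡rotationsIn w [] ⟩
  rotationsIn w []                  ∎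
  where open ≡-Reasoning

rotationsIn-++ : ∀ y z x → rotationsIn (y ++ z) x ≡ rotationsIn y (z ++ x) ++ rotationsIn z (x ++ y)
rotationsIn-++ []      z x = cong (rotationsIn z) (sym (++-identityʳ x))
rotationsIn-++ (c ∷ y) z x = cong₂ _∷_ (cong (c ∷_) (++-assoc y z x)) (begin
  rotationsIn (y ++ z) (x ∷ʳ c)
    ≡⟨ rotationsIn-++ y z (x ∷ʳ c) ⟩
  rotationsIn y (z ++ x ∷ʳ c) ++ rotationsIn z ((x ∷ʳ c) ++ y)
    ≡⟨ cong₂ (λ l m → rotationsIn y l ++ rotationsIn z m) (sym (++-assoc z x [ c ])) (++-assoc x [ c ] y) ⟩
  rotationsIn y ((z ++ x) ∷ʳ c) ++ rotationsIn z (x ++ c ∷ y)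
    ∎)
  where open ≡-Reasoning

rotations-conjugate : ∀ y z → rotations (y ++ z) ↭ rotations (z ++ y)
rotations-conjugate y z = begin
  rotations (y ++ z)                         ≡⟨ rotations≡rotationsIn (y ++ z) ⟩
  rotationsIn (y ++ z) []                    ≡⟨ rotationsIn-++ y z [] ⟩
  rotationsIn y (z ++ []) ++ rotationsIn z y ↭⟨ ↭.++-comm (rotationsIn y (z ++ [])) _ ⟩
  rotationsIn z y ++ rotationsIn y (z ++ []) ≡⟨ cong₂ (λ l m → rotationsIn z l ++ rotationsIn y m)
                                                      (sym (++-identityʳ y)) (++-identityʳ z) ⟩
  rotationsIn z (y ++ []) ++ rotationsIn y z ≡⟨ rotationsIn-++ z y [] ⟨
  rotationsIn (z ++ y) []                    ≡⟨ rotations≡rotationsIn (z ++ y) ⟨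
  rotations (z ++ y)                         ∎
  where open PermutationReasoning

last-++ : ∀ {A : Set} (xs ys : List A) {c} → last ys ≡ just c → last (xs ++ ys) ≡ just c
last-++ []            ys       eq = eq
last-++ (x ∷ [])      (y ∷ ys) eq = eq
last-++ (x ∷ x′ ∷ xs) ys       eq = last-++ (x′ ∷ xs) ys eq

last-∷ʳ : ∀ {A : Set} (xs : List A) x → last (xs ∷ʳ x) ≡ just x
last-∷ʳ xs x = last-++ xs [ x ] refl

lastChars-∷ : ∀ w {c} ws → last w ≡ just c → lastChars (w ∷ ws) ≡ c ∷ lastChars ws
lastChars-∷ w ws eq rewrite eq = refl

lastChars-++ : ∀ ws vs → lastChars (ws ++ vs) ≡ lastChars ws ++ lastChars vs
lastChars-++ []       vs = refl
lastChars-++ (w ∷ ws) vs with last w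
... | just c  = cong (c ∷_) (lastChars-++ ws vs)
... | nothing = lastChars-++ ws vs

lastChars-applyUpTo : ∀ (f : ℕ → List Sym) g n → (∀ j → j < n → last (f j) ≡ just (g j)) →
                      lastChars (applyUpTo f n) ≡ applyUpTo g n
lastChars-applyUpTo f g zero    _  = refl
lastChars-applyUpTo f g (suc n) eq = trans (lastChars-∷ (f 0) (applyUpTo (f ∘ suc) n) (eq 0 (s≤s z≤n)))
  (cong (g 0 ∷_) (lastChars-applyUpTo (f ∘ suc) (g ∘ suc) n (λ j j<n → eq (suc j) (s≤s j<n))))

lastChars-concat-applyUpTo : ∀ (F : ℕ → List (List Sym)) cs n → (∀ j → lastChars (F j) ≡ cs) →
                             lastChars (concat (applyUpTo F n)) ≡ concat (replicate n cs)
lastChars-concat-applyUpTo F cs zero    eq = refl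
lastChars-concat-applyUpTo F cs (suc n) eq = trans (lastChars-++ (F 0) _)
  (cong₂ _++_ (eq 0) (lastChars-concat-applyUpTo (F ∘ suc) cs n (eq ∘ suc)))

applyUpTo-const : ∀ {A : Set} (x : A) n → applyUpTo (λ _ → x) n ≡ replicate n x
applyUpTo-const x zero    = refl
applyUpTo-const x (suc n) = cong (x ∷_) (applyUpTo-const x n)

concat-applyUpTo-[-] : ∀ {A : Set} (f : ℕ → A) n → concat (applyUpTo (λ j → [ f j ]) n) ≡ applyUpTo f n
concat-applyUpTo-[-] f zero    = refl
concat-applyUpTo-[-] f (suc n) = cong (f 0 ∷_) (concat-applyUpTo-[-] (f ∘ suc) n)

concat-applyUpTo-suc : ∀ {A : Set} (F : ℕ → List A) n →
                       concat (applyUpTo F (suc n)) ≡ concat (applyUpTo F n) ++ F n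
concat-applyUpTo-suc F zero    = ++-identityʳ (F 0)
concat-applyUpTo-suc F (suc n) = trans (cong (F 0 ++_) (concat-applyUpTo-suc (F ∘ suc) n))
                                       (sym (++-assoc (F 0) _ (F (suc n))))

concat-applyUpTo-↭ : ∀ {A : Set} {F G : ℕ → List A} n → (∀ j → F j ↭ G j) →
                     concat (applyUpTo F n) ↭ concat (applyUpTo G n)
concat-applyUpTo-↭ zero    _  = ↭-refl
concat-applyUpTo-↭ (suc n) eq = ↭.++⁺ (eq 0) (concat-applyUpTo-↭ n (eq ∘ suc))

concat-applyUpTo-++ : ∀ {A : Set} (F G : ℕ → List A) n →
  concat (applyUpTo (λ j → F j ++ G j) n) ↭ concat (applyUpTo F n) ++ concat (applyUpTo G n)
concat-applyUpTo-++ F G zero    = ↭-refl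
concat-applyUpTo-++ F G (suc n) = begin
  (F 0 ++ G 0) ++ concat (applyUpTo (λ j → F (suc j) ++ G (suc j)) n) ≡⟨ ++-assoc (F 0) (G 0) _ ⟩
  F 0 ++ G 0 ++ concat (applyUpTo (λ j → F (suc j) ++ G (suc j)) n)   ↭⟨ ↭.++⁺ˡ (F 0) (↭.++⁺ˡ (G 0)
                                                                           (concat-applyUpTo-++ (F ∘ suc) (G ∘ suc) n)) ⟩
  F 0 ++ G 0 ++ Fs ++ Gs                                              ↭⟨ ↭.++⁺ˡ (F 0) (↭.shifts (G 0) Fs) ⟩
  F 0 ++ Fs ++ G 0 ++ Gs                                              ≡⟨ ++-assoc (F 0) Fs _ ⟨
  (F 0 ++ Fs) ++ G 0 ++ Gs                                            ∎
  where
  open PermutationReasoning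
  Fs = concat (applyUpTo (F ∘ suc) n)
  Gs = concat (applyUpTo (G ∘ suc) n)

module _ {A : Set} {R : Rel A 0ℓ} where

  linked-applyUpTo-++ : ∀ f n {zs} → (∀ j → R (f j) (f (suc j))) →
                        (∀ j → Connected R (just (f j)) (head zs)) → Linked R zs →
                        Linked R (applyUpTo f n ++ zs)
  linked-applyUpTo-++ f zero    _    _    Rzs = Rzs
  linked-applyUpTo-++ f (suc n) {zs} step join Rzs =
    link n ∷′ linked-applyUpTo-++ (f ∘ suc) n (step ∘ suc) (join ∘ suc) Rzs
    where
    link : ∀ n → Connected R (just (f 0)) (head (applyUpTo (f ∘ suc) n ++ zs))
    link zero    = join 0
    link (suc _) = just (step 0)

  linked-pairs-++ : ∀ f g n {zs} → (∀ j → R (f j) (g j)) → (∀ j → R (g j) (f (suc j))) →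
                    (∀ j → Connected R (just (g j)) (head zs)) → Linked R zs →
                    Linked R (concat (applyUpTo (λ j → f j ∷ g j ∷ []) n) ++ zs)
  linked-pairs-++ f g zero    _  _  _    Rzs = Rzs
  linked-pairs-++ f g (suc n) {zs} fg gf join Rzs =
    fg 0 ∷ link n ∷′ linked-pairs-++ (f ∘ suc) (g ∘ suc) n (fg ∘ suc) (gf ∘ suc) (join ∘ suc) Rzs
    where
    link : ∀ n → Connected R (just (g 0)) (head (concat (applyUpTo (λ j → f (suc j) ∷ g (suc j) ∷ []) n) ++ zs))
    link zero    = join 0
    link (suc _) = just (gf 0)

runsAux-++ : ∀ x xs ys → Connected _≢_ (last (x ∷ xs)) (head ys) →
             runsAux x (xs ++ ys) ≡ runsAux x xs + runs ys
runsAux-++ x []        []       _          = refl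
runsAux-++ x []        (y ∷ ys) (just x≢y) rewrite ≢⇒≡ₛ-false x≢y = refl
runsAux-++ x (x′ ∷ xs) ys       join with x ≡ₛ x′
... | true  = runsAux-++ x′ xs ys join
... | false = cong suc (runsAux-++ x′ xs ys join)

runs-++ : ∀ xs ys → Connected _≢_ (last xs) (head ys) → runs (xs ++ ys) ≡ runs xs + runs ys
runs-++ []       ys _    = refl
runs-++ (x ∷ xs) ys join = runsAux-++ x xs ys join

runs-linked : ∀ {xs} → Linked _≢_ xs → runs xs ≡ length xs
runs-linked {[]}     _      = refl
runs-linked {x ∷ xs} linked = trans (runs-++ [ x ] xs (head′ linked)) (cong suc (runs-linked (tail linked)))

runs-replicate : ∀ n x → runs (replicate (suc n) x) ≡ 1
runs-replicate zero    x = refl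
runs-replicate (suc n) x rewrite ≡ₛ-refl x = runs-replicate n x

length-alternating : ∀ {A : Set} (x y : A) m → length (concat (replicate m (x ∷ y ∷ []))) ≡ m * 2
length-alternating x y zero    = refl
length-alternating x y (suc m) = cong (2 +_) (length-alternating x y m)

segment : ℕ → List Sym
segment j = sa ∷ sb ∷ amp j ∷ sa ∷ hash j ∷ []

segments : ℕ → ℕ → List Sym
segments i zero    = []
segments i (suc d) = segment (i + suc d) ++ segments i d

segments-snoc : ∀ i d → segments (suc i) d ++ segment (suc i) ≡ segments i (suc d)
segments-snoc i zero    = cong segment (+-comm 1 i)
segments-snoc i (suc d) = cong₂ _++_ (cong segment (sym (+-suc i (suc d)))) (segments-snoc i d)

last-segments : ∀ m → last (segments 0 (suc m)) ≡ just (hash 1)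
last-segments m = trans (cong last (sym (segments-snoc 0 m))) (last-++ (segments 1 m) (segment 1) refl)

u-snoc : ∀ n → u (suc n) ≡ u n ++ block (suc n)
u-snoc = concat-applyUpTo-suc (block ∘ suc)

reverse-u : ∀ n → reverse (u (suc n)) ≡ (amp (suc n) ∷ sa ∷ hash (suc n) ∷ segments 0 n) ++ sa ∷ sb ∷ []
reverse-u zero    = refl
reverse-u (suc n) = begin
  reverse (u (suc (suc n)))                            ≡⟨ cong reverse (u-snoc (suc n)) ⟩
  reverse (u (suc n) ++ block (suc (suc n)))           ≡⟨ reverse-++ (u (suc n)) _ ⟩
  reverse (block (suc (suc n))) ++ reverse (u (suc n)) ≡⟨ cong (reverse (block (suc (suc n))) ++_) (reverse-u n) ⟩
  (amp (suc (suc n)) ∷ sa ∷ hash (suc (suc n)) ∷ segments 0 (suc n)) ++ sa ∷ sb ∷ [] ∎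
  where open ≡-Reasoning

rotations-reverse-u : ∀ n → rotations (reverse (u (suc n))) ↭ rotations (segments 0 (suc n))
rotations-reverse-u n = begin
  rotations (reverse (u (suc n)))                                              ≡⟨ cong rotations (reverse-u n) ⟩
  rotations ((amp (suc n) ∷ sa ∷ hash (suc n) ∷ segments 0 n) ++ sa ∷ sb ∷ []) ↭⟨ rotations-conjugate _ (sa ∷ sb ∷ []) ⟩
  rotations (segments 0 (suc n))                                               ∎
  where open PermutationReasoning

module SortedRotations (n : ℕ) where

  k : ℕ
  k = suc n

  -- What follows segment j in the cyclic word segments 0 k.
  context : ℕ → List Sym
  context j = segments 0 (pred j) ++ segments j (k ∸ j)

  -- family j computes to rotAB j ∷ rotB j ∷ rotAmp j ∷ rotA j ∷ rotHash j ∷ [].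
  rotAB rotB rotAmp rotA rotHash : ℕ → List Sym
  rotAB   j = segment j ++ context j
  rotB    j = sb ∷ amp j ∷ sa ∷ hash j ∷ (context j ∷ʳ sa)
  rotAmp  j = amp j ∷ sa ∷ hash j ∷ (context j ∷ʳ sa ∷ʳ sb)
  rotA    j = sa ∷ hash j ∷ (context j ∷ʳ sa ∷ʳ sb ∷ʳ amp j)
  rotHash j = hash j ∷ (context j ∷ʳ sa ∷ʳ sb ∷ʳ amp j ∷ʳ sa)

  family : ℕ → List (List Sym)
  family j = rotationsIn (segment j) (context j)

  sortedRotations : List (List Sym)
  sortedRotations = concat (applyUpTo (λ j → rotHash (suc j) ∷ rotAmp (suc j) ∷ []) k)
                 ++ applyUpTo (rotA ∘ suc) k ++ applyUpTo (rotAB ∘ suc) k ++ applyUpTo (rotB ∘ suc) k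

  sortedRotations-sorted : Sorted sortedRotations
  sortedRotations-sorted =
    linked-pairs-++ (rotHash ∘ suc) (rotAmp ∘ suc) k
      (λ j → ≼-head (hash<amp (suc j))) (λ j → ≼-head (n<ᵇ1+n (suc j))) (λ _ → just (≼⁺ _))
      (linked-applyUpTo-++ (rotA ∘ suc) k (λ j → ≼-tail (≼-head (n<ᵇ1+n (suc j)))) (λ _ → just (≼⁺ _))
        (linked-applyUpTo-++ (rotAB ∘ suc) k (λ j → ≼-tail (≼-tail (≼-head (n<ᵇ1+n (suc j))))) (λ _ → just (≼⁺ _))
          (applyUpTo⁺₂ (rotB ∘ suc) k (λ j → ≼-tail (≼-head (n<ᵇ1+n (suc j)))))))

  family-decomposition : ∀ i d → i + d ≡ k →
    rotationsIn (segments 0 i) (segments i d) ↭ concat (applyUpTo (family ∘ suc) i)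
  family-decomposition zero    d _  = ↭-refl
  family-decomposition (suc i) d eq = begin
    rotationsIn (segment (suc i) ++ segments 0 i) (segments (suc i) d)
      ≡⟨ rotationsIn-++ (segment (suc i)) (segments 0 i) (segments (suc i) d) ⟩
    rotationsIn (segment (suc i)) (segments 0 i ++ segments (suc i) d)
      ++ rotationsIn (segments 0 i) (segments (suc i) d ++ segment (suc i))
      ≡⟨ cong₂ (λ e s → rotationsIn (segment (suc i)) (segments 0 i ++ segments (suc i) e)
                        ++ rotationsIn (segments 0 i) s)
               (trans (sym (m+n∸m≡n (suc i) d)) (cong (_∸ suc i) eq)) (segments-snoc i d) ⟩
    family (suc i) ++ rotationsIn (segments 0 i) (segments i (suc d))
      ↭⟨ ↭.++⁺ˡ (family (suc i)) (family-decomposition i (suc d) (trans (+-suc i d) eq)) ⟩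
    family (suc i) ++ concat (applyUpTo (family ∘ suc) i)
      ↭⟨ ↭.++-comm (family (suc i)) _ ⟩
    concat (applyUpTo (family ∘ suc) i) ++ family (suc i)
      ≡⟨ concat-applyUpTo-suc (family ∘ suc) i ⟨
    concat (applyUpTo (family ∘ suc) (suc i)) ∎
    where open PermutationReasoning

  family-reorder : ∀ j → family j ↭ (rotHash j ∷ rotAmp j ∷ []) ++ [ rotA j ] ++ [ rotAB j ] ++ [ rotB j ]
  family-reorder j = ↭-trans (↭.++-comm (rotAB j ∷ rotB j ∷ []) (rotAmp j ∷ rotA j ∷ rotHash j ∷ []))
                             (↭.++⁺ʳ _ (↭-sym (↭.∷↭∷ʳ (rotHash j) (rotAmp j ∷ rotA j ∷ []))))

  families-↭-sortedRotations : concat (applyUpTo (family ∘ suc) k) ↭ sortedRotations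
  families-↭-sortedRotations = begin
    concat (applyUpTo (family ∘ suc) k)
      ↭⟨ concat-applyUpTo-↭ k (family-reorder ∘ suc) ⟩
    concat (applyUpTo (λ j → sepPair j ++ [ rA j ] ++ [ rAB j ] ++ [ rB j ]) k)
      ↭⟨ concat-applyUpTo-++ sepPair (λ j → [ rA j ] ++ [ rAB j ] ++ [ rB j ]) k ⟩
    sepPairs ++ concat (applyUpTo (λ j → [ rA j ] ++ [ rAB j ] ++ [ rB j ]) k)
      ↭⟨ ↭.++⁺ˡ sepPairs (concat-applyUpTo-++ (λ j → [ rA j ]) (λ j → [ rAB j ] ++ [ rB j ]) k) ⟩
    sepPairs ++ concat (applyUpTo (λ j → [ rA j ]) k) ++ concat (applyUpTo (λ j → [ rAB j ] ++ [ rB j ]) k)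
      ↭⟨ ↭.++⁺ˡ sepPairs (↭.++⁺ˡ (concat (applyUpTo (λ j → [ rA j ]) k))
                             (concat-applyUpTo-++ (λ j → [ rAB j ]) (λ j → [ rB j ]) k)) ⟩
    sepPairs ++ concat (applyUpTo (λ j → [ rA j ]) k) ++ concat (applyUpTo (λ j → [ rAB j ]) k)
        ++ concat (applyUpTo (λ j → [ rB j ]) k)
      ≡⟨ cong (sepPairs ++_) (cong₂ _++_ (concat-applyUpTo-[-] rA k)
                                    (cong₂ _++_ (concat-applyUpTo-[-] rAB k) (concat-applyUpTo-[-] rB k))) ⟩
    sortedRotations ∎
    where
    open PermutationReasoning
    sepPair : ℕ → List (List Sym)
    sepPair j = rotHash (suc j) ∷ rotAmp (suc j) ∷ []
    sepPairs : List (List Sym)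
    sepPairs = concat (applyUpTo sepPair k)
    rA rAB rB : ℕ → List Sym
    rA  = rotA ∘ suc
    rAB = rotAB ∘ suc
    rB  = rotB ∘ suc

  rotations-↭-sortedRotations : rotations (reverse (u k)) ↭ sortedRotations
  rotations-↭-sortedRotations = begin
    rotations (reverse (u k))           ↭⟨ rotations-reverse-u n ⟩
    rotations (segments 0 k)            ≡⟨ rotations≡rotationsIn (segments 0 k) ⟩
    rotationsIn (segments 0 k) []       ↭⟨ family-decomposition k 0 (+-identityʳ k) ⟩
    concat (applyUpTo (family ∘ suc) k) ↭⟨ families-↭-sortedRotations ⟩
    sortedRotations                     ∎
    where open PermutationReasoning

  context-below : ∀ j → j < n →
    context (suc j) ≡ segments 0 j ++ segments (suc (suc j)) (n ∸ suc j) ++ segment (suc (suc j))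
  context-below j j<n = cong (segments 0 j ++_) (trans (cong (segments (suc j)) (+-∸-assoc 1 j<n))
                                                       (sym (segments-snoc (suc j) (n ∸ suc j))))

  context-top : context k ≡ segments 0 n
  context-top = trans (cong (λ d → segments 0 n ++ segments k d) (n∸n≡0 n)) (++-identityʳ (segments 0 n))

  last-rotAB-below : ∀ j → j < n → last (rotAB (suc j)) ≡ just (hash (suc (suc j)))
  last-rotAB-below j j<n = last-++ (segment (suc j)) (context (suc j)) (trans (cong last (context-below j j<n))
    (last-++ (segments 0 j) _ (last-++ (segments (suc (suc j)) (n ∸ suc j)) (segment (suc (suc j))) refl)))

  last-rotAB-top : last (rotAB k) ≡ just (hash 1)
  last-rotAB-top = trans (cong (λ c → last (segment k ++ c)) context-top) (last-segments n)

  lastChars-sepPair : ∀ j → lastChars (rotHash j ∷ rotAmp j ∷ []) ≡ sa ∷ sb ∷ []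
  lastChars-sepPair j =
    trans (lastChars-∷ (rotHash j) _ (last-∷ʳ (hash j ∷ (context j ∷ʳ sa ∷ʳ sb ∷ʳ amp j)) sa))
          (cong (sa ∷_) (lastChars-∷ (rotAmp j) [] (last-∷ʳ (amp j ∷ sa ∷ hash j ∷ (context j ∷ʳ sa)) sb)))

  lastChars-sortedRotations : lastChars sortedRotations ≡ expectedBWT k
  lastChars-sortedRotations = begin
    lastChars (sepPairs ++ As ++ ABs ++ Bs)
      ≡⟨ trans (lastChars-++ sepPairs _) (cong (lastChars sepPairs ++_)
           (trans (lastChars-++ As _) (cong (lastChars As ++_) (lastChars-++ ABs Bs)))) ⟩
    lastChars sepPairs ++ lastChars As ++ lastChars ABs ++ lastChars Bs
      ≡⟨ cong₂ _++_ lastChars-sepPairs (cong₂ _++_ lastChars-As (cong₂ _++_ lastChars-ABs lastChars-Bs)) ⟩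
    concat (replicate k (sa ∷ sb ∷ [])) ++ applyUpTo (amp ∘ suc) k ++ (hashes ++ [ hash 1 ]) ++ replicate k sa
      ≡⟨ cong (λ l → concat (replicate k (sa ∷ sb ∷ [])) ++ applyUpTo (amp ∘ suc) k ++ l)
              (++-assoc hashes [ hash 1 ] (replicate k sa)) ⟩
    expectedBWT k ∎
    where
    open ≡-Reasoning
    sepPairs As ABs Bs : List (List Sym)
    sepPairs = concat (applyUpTo (λ j → rotHash (suc j) ∷ rotAmp (suc j) ∷ []) k)
    As  = applyUpTo (rotA ∘ suc) k
    ABs = applyUpTo (rotAB ∘ suc) k
    Bs  = applyUpTo (rotB ∘ suc) k
    hashes : List Sym
    hashes = applyUpTo (λ j → hash (suc (suc j))) n

    lastChars-sepPairs : lastChars sepPairs ≡ concat (replicate k (sa ∷ sb ∷ []))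
    lastChars-sepPairs = lastChars-concat-applyUpTo (λ j → rotHash (suc j) ∷ rotAmp (suc j) ∷ [])
                                                    (sa ∷ sb ∷ []) k (lastChars-sepPair ∘ suc)

    lastChars-As : lastChars As ≡ applyUpTo (amp ∘ suc) k
    lastChars-As = lastChars-applyUpTo (rotA ∘ suc) (amp ∘ suc) k
      (λ j _ → last-∷ʳ (sa ∷ hash (suc j) ∷ (context (suc j) ∷ʳ sa ∷ʳ sb)) (amp (suc j)))

    lastChars-ABs : lastChars ABs ≡ hashes ++ [ hash 1 ]
    lastChars-ABs = begin
      lastChars ABs                                                 ≡⟨ cong lastChars (applyUpTo-∷ʳ (rotAB ∘ suc) n) ⟨
      lastChars (applyUpTo (rotAB ∘ suc) n ++ [ rotAB k ])           ≡⟨ lastChars-++ (applyUpTo (rotAB ∘ suc) n) _ ⟩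
      lastChars (applyUpTo (rotAB ∘ suc) n) ++ lastChars [ rotAB k ] ≡⟨ cong₂ _++_
        (lastChars-applyUpTo (rotAB ∘ suc) (λ j → hash (suc (suc j))) n last-rotAB-below)
        (lastChars-∷ (rotAB k) [] last-rotAB-top) ⟩
      hashes ++ [ hash 1 ]                                          ∎

    lastChars-Bs : lastChars Bs ≡ replicate k sa
    lastChars-Bs = trans (lastChars-applyUpTo (rotB ∘ suc) (λ _ → sa) k
                           (λ j _ → last-∷ʳ (sb ∷ amp (suc j) ∷ sa ∷ hash (suc j) ∷ context (suc j)) sa))
                         (applyUpTo-const sa k)

bwt-reverse-u : ∀ n → BWT (reverse (u (suc n))) ≡ expectedBWT (suc n)
bwt-reverse-u n = trans (cong lastChars (sortWords-unique sortedRotations-sorted rotations-↭-sortedRotations))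
                        lastChars-sortedRotations
  where open SortedRotations n

module ExpectedBWT (n : ℕ) where

  k : ℕ
  k = suc n

  alternating ascendingAmps hashes distinctPrefix : List Sym
  alternating    = concat (replicate k (sa ∷ sb ∷ []))
  ascendingAmps  = applyUpTo (amp ∘ suc) k
  hashes         = applyUpTo (λ j → hash (suc (suc j))) n
  distinctPrefix = alternating ++ ascendingAmps ++ hashes ++ [ hash 1 ]

  expectedBWT-split : expectedBWT k ≡ distinctPrefix ++ replicate k sa
  expectedBWT-split = sym (trans (++-assoc alternating _ (replicate k sa))
    (cong (alternating ++_) (trans (++-assoc ascendingAmps _ (replicate k sa))
      (cong (ascendingAmps ++_) (++-assoc hashes [ hash 1 ] (replicate k sa))))))

  distinctPrefix-linked : Linked _≢_ distinctPrefix
  distinctPrefix-linked =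
    subst (λ l → Linked _≢_ (concat l ++ ascendingAmps ++ hashes ++ [ hash 1 ])) (applyUpTo-const (sa ∷ sb ∷ []) k)
      (linked-pairs-++ (λ _ → sa) (λ _ → sb) k (λ _ ()) (λ _ ()) (λ _ → just λ ())
        (linked-applyUpTo-++ (amp ∘ suc) k (λ _ ()) (λ _ → amp≢head n)
          (linked-applyUpTo-++ (λ j → hash (suc (suc j))) n (λ _ ()) (λ _ → just λ ()) [-])))
    where
    amp≢head : ∀ m {i} → Connected _≢_ (just (amp i)) (head (applyUpTo (λ j → hash (suc (suc j))) m ++ [ hash 1 ]))
    amp≢head zero    = just λ ()
    amp≢head (suc _) = just λ ()

  last-distinctPrefix : last distinctPrefix ≡ just (hash 1)
  last-distinctPrefix = last-++ alternating _ (last-++ ascendingAmps _ (last-∷ʳ hashes (hash 1)))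

  length-distinctPrefix : length distinctPrefix ≡ k * 2 + (k + (n + 1))
  length-distinctPrefix = trans (length-++ alternating) (cong₂ _+_ (length-alternating sa sb k)
    (trans (length-++ ascendingAmps) (cong₂ _+_ (length-applyUpTo (amp ∘ suc) k)
      (trans (length-++ hashes) (cong (_+ 1) (length-applyUpTo _ n))))))

  runs-expectedBWT : runs (expectedBWT k) ≡ 4 * k + 1
  runs-expectedBWT = begin
    runs (expectedBWT k)                        ≡⟨ cong runs expectedBWT-split ⟩
    runs (distinctPrefix ++ replicate k sa)     ≡⟨ runs-++ distinctPrefix _ prefix≢sa ⟩
    runs distinctPrefix + runs (replicate k sa) ≡⟨ cong₂ _+_ (runs-linked distinctPrefix-linked) (runs-replicate n sa) ⟩
    length distinctPrefix + 1                   ≡⟨ cong (_+ 1) length-distinctPrefix ⟩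
    k * 2 + (k + (n + 1)) + 1                   ≡⟨ arithmetic n ⟩
    4 * k + 1                                   ∎
    where
    open ≡-Reasoning
    prefix≢sa : Connected _≢_ (last distinctPrefix) (just sa)
    prefix≢sa = subst (λ c → Connected _≢_ c (just sa)) (sym last-distinctPrefix) (just λ ())
    arithmetic : ∀ n → suc n * 2 + (suc n + (n + 1)) + 1 ≡ 4 * suc n + 1
    arithmetic = solve-∀

lemma3p3 : (k : ℕ) → k ≥ 1 →
    (BWT (reverse (u k)) ≡ expectedBWT k) × (r (reverse (u k)) ≡ 4 * k + 1)
lemma3p3 (suc n) _ = bwt-reverse-u n , trans (cong runs (bwt-reverse-u n)) (ExpectedBWT.runs-expectedBWT n)
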